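{- For $n\ge 4$, the suspension of the $n$-cycle satisfies $\nu^*(\Sigma C_n)=13n^2+2n$.
   Context: The suspension $\Sigma G$ of a graph $G$ is the join of $G$ with a set of two non-adjacent new vertices, i.e. two new vertices each adjacent to every vertex of $G$ but not to each other. For a finite simple graph $G=(V,E)$ with $p=|V|$, $q=|E|$, $\ell=p+q$, a construction sequence (c-sequence) for $G$ is a bijection $x:\{1,\dots,\ell\}\to V\sqcup E$ such that for every edge $e=uw$, $x^{ -1}(e)>\max\{x^{ -1}(u),x^{ -1}(w)\}$. The cost of an edge $e=uw$ in $x$ is $\nu(e,x)=(x^{ -1}(e)-x^{ -1}(u))+(x^{ -1}(e)-x^{ -1}(w))$, and the cost of $x$ is $\nu(x)=\sum_{e\in E}\nu(e,x)$. The max cost of $G$ is $\nu^*(G)=\max\nu(x)$ over all c-sequences $x$ for $G$. -}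

module Defs where

open import Data.Nat using (ℕ; zero; suc; _+_; _*_; _∸_; _<_; _≤_)
open import Data.Nat.DivMod using (_mod_)
import Data.Fin
open import Data.Fin using (Fin; toℕ; _↑ˡ_; _↑ʳ_; splitAt)
open import Data.Fin.Properties using (_≟_)
open import Data.Product using (_×_; _,_; proj₁; proj₂; ∃-syntax)
open import Data.Sum using (_⊎_; inj₁; inj₂)
open import Relation.Nullary using (¬_)
open import Relation.Binary.PropositionalEquality using (_≡_)
open import Function.Bundles using (_↔_; Inverse)

record Graph : Set where
  field
    p    : ℕ
    q    : ℕ
    ends : Fin q → Fin p × Fin p

open Graph public

IsSimple : Graph → Set
IsSimple G =
  (∀ e → ¬ (proj₁ (ends G e) ≡ proj₂ (ends G e))) ×
  (∀ e f → ((ends G e ≡ ends G f) ⊎ (ends G e ≡ (proj₂ (ends G f) , proj₁ (ends G f)))) → e ≡ f)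

Elem : Graph → Set
Elem G = Fin (p G) ⊎ Fin (q G)

len : Graph → ℕ
len G = p G + q G

-- x : {1..ℓ} → V ⊔ E bijection (positions 0-based; only differences matter)
Bij : Graph → Set
Bij G = Fin (len G) ↔ Elem G

pos : (G : Graph) → Bij G → Elem G → ℕ
pos G x a = toℕ (Inverse.from x a)

IsCSeq : (G : Graph) → Bij G → Set
IsCSeq G x = ∀ e →
  (pos G x (inj₁ (proj₁ (ends G e))) < pos G x (inj₂ e)) ×
  (pos G x (inj₁ (proj₂ (ends G e))) < pos G x (inj₂ e))

sumFin : (n : ℕ) → (Fin n → ℕ) → ℕ
sumFin zero    f = 0
sumFin (suc n) f = f Fin.zero + sumFin n (λ i → f (Fin.suc i))

edgeCost : (G : Graph) → Bij G → Fin (q G) → ℕ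
edgeCost G x e =
  (pos G x (inj₂ e) ∸ pos G x (inj₁ (proj₁ (ends G e)))) +
  (pos G x (inj₂ e) ∸ pos G x (inj₁ (proj₂ (ends G e))))

cost : (G : Graph) → Bij G → ℕ
cost G x = sumFin (q G) (edgeCost G x)

-- ν*(G) = N : N is the maximum cost over all c-sequences
MaxCost : Graph → ℕ → Set
MaxCost G N =
  (∃[ x ] (IsCSeq G x × cost G x ≡ N)) ×
  (∀ x → IsCSeq G x → cost G x ≤ N)

-- the n-cycle C_n (meaningful for n ≥ 3): vertices 0..n-1, edge i joins i and i+1 mod n
cycle : ℕ → Graph
cycle zero    = record { p = 0 ; q = 0 ; ends = λ () }
cycle (suc m) = record { p = suc m ; q = suc m
                       ; ends = λ i → (i , (suc (toℕ i)) mod (suc m)) }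

suspension : Graph → Graph
suspension G = record { p = p G + 2 ; q = q G + (p G + p G) ; ends = es }
  where
  apex0 apex1 : Fin (p G + 2)
  apex0 = p G ↑ʳ Fin.zero
  apex1 = p G ↑ʳ Fin.suc Fin.zero
  es : Fin (q G + (p G + p G)) → Fin (p G + 2) × Fin (p G + 2)
  es j with splitAt (q G) j
  ... | inj₁ e with ends G e
  ...   | (u , w) = (u ↑ˡ 2 , w ↑ˡ 2)
  es j | inj₂ k with splitAt (p G) k
  ... | inj₁ v = (v ↑ˡ 2 , apex0)
  ... | inj₂ v = (v ↑ˡ 2 , apex1)

-- Summed over the edges, the cost of a c-sequence is 2 Σₑ pos e − Σᵥ deg v · pos v, and the
-- positions of all elements are a permutation of 0, …, ℓ − 1. In ΣCₙ the cycle vertices have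
-- degree 4 and the two apexes degree n, so with s the position sum of the cycle vertices, a₀, a₁
-- the apex positions and T k = 0 + 1 + ⋯ + (k − 1) this becomes
--   cost + 6 s + (n + 2)(a₀ + a₁) = 2 T (4n + 2).
-- The n + 2 vertex positions are distinct, so s + a₀ + a₁ ≥ T (n + 2), and a₀ + a₁ ≥ 1; for n ≥ 4
-- this yields cost ≤ 13n² + 2n, with equality when the apexes come first, then the cycle
-- vertices, then the edges.
module Submission where

open import Defs
open import Data.Nat using (ℕ; zero; suc; _+_; _*_; _∸_; _≤_; _<_; s≤s; z≤n)
open import Data.Nat.Properties
open import Data.Nat.DivMod using (_mod_; _%_; m<n⇒m%n≡m; n%n≡0)
open import Data.Nat.Tactic.RingSolver using (solve-∀)
open import Data.Fin as Fin using (Fin; toℕ; _↑ˡ_; _↑ʳ_; splitAt; inject₁; fromℕ; fromℕ<)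
open import Data.Fin.Properties as FinP
  using (toℕ-injective; toℕ<n; toℕ-↑ˡ; toℕ-↑ʳ; toℕ-fromℕ<; toℕ-inject₁; toℕ-fromℕ; toℕ-cast;
         splitAt-↑ˡ; splitAt-↑ʳ; ↑ʳ-injective; punchIn-injective; pigeonhole; ¬∀⟶∃¬; +↔⊎)
open import Data.Fin.Permutation using (cast-id)
open import Data.Vec.Functional using (removeAt)
open import Data.Product using (_×_; _,_; proj₁; proj₂; ∃-syntax)
open import Data.Sum using (inj₁; inj₂; swap)
open import Data.Sum.Properties using (inj₁-injective)
open import Data.Sum.Algebra using (⊎-comm)
open import Data.Sum.Function.Propositional using (_⊎-↔_)
open import Function using (_∘_; Injective)
open import Function.Bundles using (_↔_; Inverse; Injection)
open import Function.Properties.Inverse using (↔-refl; ↔-sym; ↔-trans; ↔⇒↣)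
open import Relation.Binary.PropositionalEquality
open import Relation.Nullary using (¬_; contradiction)
open import Algebra.Properties.CommutativeMonoid.Sum +-0-commutativeMonoid
  using (sum; sum-syntax; sum-cong-≗; ∑-distrib-+; sum-init-last; sum-remove; sum-permute)

sumFin≡sum : ∀ n (f : Fin n → ℕ) → sumFin n f ≡ sum f
sumFin≡sum zero    f = refl
sumFin≡sum (suc n) f = cong (f Fin.zero +_) (sumFin≡sum n (f ∘ Fin.suc))

∑-const : ∀ n c → ∑[ i < n ] c ≡ n * c
∑-const zero    c = refl
∑-const (suc n) c = cong (c +_) (∑-const n c)

∑-↑ : ∀ m n (f : Fin (m + n) → ℕ) → sum f ≡ ∑[ i < m ] f (i ↑ˡ n) + ∑[ j < n ] f (m ↑ʳ j)
∑-↑ zero    n f = refl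
∑-↑ (suc m) n f =
  trans (cong (f Fin.zero +_) (∑-↑ m n (f ∘ Fin.suc))) (sym (+-assoc (f Fin.zero) _ _))

∑-rotate : ∀ m (g : Fin (suc m) → ℕ) → ∑[ i < suc m ] g ((suc (toℕ i)) mod (suc m)) ≡ sum g
∑-rotate m g = begin
  ∑[ i < suc m ] g (next i)                            ≡⟨ sum-init-last (g ∘ next) ⟩
  ∑[ i < m ] g (next (inject₁ i)) + g (next (fromℕ m)) ≡⟨ cong₂ _+_ (sum-cong-≗ (cong g ∘ next-inject₁))
                                                                     (cong g next-last) ⟩
  ∑[ i < m ] g (Fin.suc i) + g Fin.zero                ≡⟨ +-comm _ (g Fin.zero) ⟩
  sum g                                                ∎
  where
  open ≡-Reasoning
  next : Fin (suc m) → Fin (suc m)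
  next i = (suc (toℕ i)) mod (suc m)
  next-inject₁ : ∀ i → next (inject₁ i) ≡ Fin.suc i
  next-inject₁ i = toℕ-injective (begin
    toℕ (next (inject₁ i))        ≡⟨ toℕ-fromℕ< _ ⟩
    suc (toℕ (inject₁ i)) % suc m ≡⟨ cong (λ z → suc z % suc m) (toℕ-inject₁ i) ⟩
    suc (toℕ i) % suc m           ≡⟨ m<n⇒m%n≡m (s≤s (toℕ<n i)) ⟩
    suc (toℕ i)                   ∎)
  next-last : next (fromℕ m) ≡ Fin.zero
  next-last = toℕ-injective (begin
    toℕ (next (fromℕ m))        ≡⟨ toℕ-fromℕ< _ ⟩
    suc (toℕ (fromℕ m)) % suc m ≡⟨ cong (λ z → suc z % suc m) (toℕ-fromℕ m) ⟩
    suc m % suc m               ≡⟨ n%n≡0 (suc m) ⟩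
    0                           ∎)

≢⇒1≤+ : ∀ {a b} → a ≢ b → 1 ≤ a + b
≢⇒1≤+ {zero}  {zero}  0≢0 = contradiction refl 0≢0
≢⇒1≤+ {zero}  {suc b} _   = s≤s z≤n
≢⇒1≤+ {suc a}         _   = s≤s z≤n

triangle : ℕ → ℕ
triangle zero    = 0
triangle (suc n) = n + triangle n

2*triangle+n≡n*n : ∀ n → 2 * triangle n + n ≡ n * n
2*triangle+n≡n*n zero    = refl
2*triangle+n≡n*n (suc n) = begin
  2 * (n + triangle n) + suc n       ≡⟨ regroup n (triangle n) ⟩
  (2 * triangle n + n) + (n + suc n) ≡⟨ cong (_+ (n + suc n)) (2*triangle+n≡n*n n) ⟩
  n * n + (n + suc n)                ≡⟨ square-suc n ⟩
  suc n * suc n                      ∎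
  where
  open ≡-Reasoning
  regroup : ∀ n t → 2 * (n + t) + suc n ≡ (2 * t + n) + (n + suc n)
  regroup = solve-∀
  square-suc : ∀ n → n * n + (n + suc n) ≡ suc n * suc n
  square-suc = solve-∀

∑-toℕ : ∀ n → ∑[ i < n ] toℕ i ≡ triangle n
∑-toℕ zero    = refl
∑-toℕ (suc n) = begin
  ∑[ i < suc n ] toℕ i                       ≡⟨ sum-init-last {n} toℕ ⟩
  ∑[ i < n ] toℕ (inject₁ i) + toℕ (fromℕ n) ≡⟨ cong₂ _+_ (sum-cong-≗ {n} toℕ-inject₁) (toℕ-fromℕ n) ⟩
  ∑[ i < n ] toℕ i + n                       ≡⟨ cong (_+ n) (∑-toℕ n) ⟩
  triangle n + n                             ≡⟨ +-comm (triangle n) n ⟩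
  triangle (suc n)                           ∎
  where open ≡-Reasoning

injective⇒∃≥ : ∀ n (f : Fin (suc n) → ℕ) → Injective _≡_ _≡_ f → ∃[ i ] n ≤ f i
injective⇒∃≥ n f f-inj =
  let i , fi≮n = ¬∀⟶∃¬ (suc n) (λ i → f i < n) (λ i → f i <? n) not-all-below
  in  i , ≮⇒≥ fi≮n
  where
  not-all-below : ¬ (∀ i → f i < n)
  not-all-below below =
    let i , j , i<j , same = pigeonhole (n<1+n n) (λ i → fromℕ< (below i))
    in  FinP.<⇒≢ i<j (f-inj (begin
      f i                    ≡⟨ toℕ-fromℕ< (below i) ⟨
      toℕ (fromℕ< (below i)) ≡⟨ cong toℕ same ⟩
      toℕ (fromℕ< (below j)) ≡⟨ toℕ-fromℕ< (below j) ⟩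
      f j                    ∎))
    where open ≡-Reasoning

-- Peel off a value ≥ n (which exists by pigeonhole) and recurse on the rest.
triangle≤∑-injective : ∀ n (f : Fin n → ℕ) → Injective _≡_ _≡_ f → triangle n ≤ sum f
triangle≤∑-injective zero    f f-inj = z≤n
triangle≤∑-injective (suc n) f f-inj = begin
  n + triangle n           ≤⟨ +-mono-≤ n≤fi (triangle≤∑-injective n (removeAt f i) rest-inj) ⟩
  f i + sum (removeAt f i) ≡⟨ sum-remove f ⟨
  sum f                    ∎
  where
  open ≤-Reasoning
  i = proj₁ (injective⇒∃≥ n f f-inj)
  n≤fi = proj₂ (injective⇒∃≥ n f f-inj)
  rest-inj : Injective _≡_ _≡_ (removeAt f i)
  rest-inj = punchIn-injective i _ _ ∘ f-inj

module _ (G : Graph) (x : Bij G) where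

  vertexPos : Fin (p G) → ℕ
  vertexPos v = pos G x (inj₁ v)

  edgePos : Fin (q G) → ℕ
  edgePos e = pos G x (inj₂ e)

  endsPos : Fin (q G) → ℕ
  endsPos e = vertexPos (proj₁ (ends G e)) + vertexPos (proj₂ (ends G e))

  pos-injective : Injective _≡_ _≡_ (pos G x)
  pos-injective = Injection.injective (↔⇒↣ (↔-sym x)) ∘ toℕ-injective

  triangle≤∑vertexPos : triangle (p G) ≤ sum vertexPos
  triangle≤∑vertexPos = triangle≤∑-injective (p G) vertexPos (inj₁-injective ∘ pos-injective)

  -- The positions are a permutation of 0, …, len G − 1.
  ∑vertexPos+∑edgePos≡triangle : sum vertexPos + sum edgePos ≡ triangle (len G)
  ∑vertexPos+∑edgePos≡triangle = begin
    sum vertexPos + sum edgePos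
      ≡⟨ cong₂ _+_ (sum-cong-≗ (λ v → cong (pos G x) (splitAt-↑ˡ (p G) v (q G))))
                   (sum-cong-≗ (cong (pos G x) ∘ splitAt-↑ʳ (p G) (q G))) ⟨
    ∑[ v < p G ] pos G x (splitAt (p G) (v ↑ˡ q G)) + ∑[ e < q G ] pos G x (splitAt (p G) (p G ↑ʳ e))
      ≡⟨ ∑-↑ (p G) (q G) (pos G x ∘ splitAt (p G)) ⟨
    ∑[ i < len G ] toℕ (Inverse.to π i)
      ≡⟨ sum-permute toℕ π ⟨
    ∑[ i < len G ] toℕ i
      ≡⟨ ∑-toℕ (len G) ⟩
    triangle (len G) ∎
    where
    open ≡-Reasoning
    π : Fin (len G) ↔ Fin (len G)
    π = ↔-trans +↔⊎ (↔-sym x)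

  cost+∑endsPos : IsCSeq G x → cost G x + sum endsPos ≡ sum edgePos + sum edgePos
  cost+∑endsPos cs = begin
    cost G x + sum endsPos                      ≡⟨ cong (_+ sum endsPos) (sumFin≡sum (q G) (edgeCost G x)) ⟩
    sum (edgeCost G x) + sum endsPos            ≡⟨ ∑-distrib-+ (edgeCost G x) endsPos ⟨
    ∑[ e < q G ] (edgeCost G x e + endsPos e)   ≡⟨ sum-cong-≗ edgeCost+endsPos ⟩
    ∑[ e < q G ] (edgePos e + edgePos e)        ≡⟨ ∑-distrib-+ edgePos edgePos ⟩
    sum edgePos + sum edgePos                   ∎
    where
    open ≡-Reasoning
    edgeCost+endsPos : ∀ e → edgeCost G x e + endsPos e ≡ edgePos e + edgePos e
    edgeCost+endsPos e = begin
      (a ∸ u) + (a ∸ w) + (u + w)     ≡⟨ regroup (a ∸ u) (a ∸ w) u w ⟩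
      ((a ∸ u) + u) + ((a ∸ w) + w)   ≡⟨ cong₂ _+_ (m∸n+n≡m (<⇒≤ (proj₁ (cs e))))
                                                   (m∸n+n≡m (<⇒≤ (proj₂ (cs e)))) ⟩
      a + a                           ∎
      where
      a = edgePos e
      u = vertexPos (proj₁ (ends G e))
      w = vertexPos (proj₂ (ends G e))
      regroup : ∀ a b c d → a + b + (c + d) ≡ (a + c) + (b + d)
      regroup = solve-∀

module _ (G : Graph) where

  private
    ΣG = suspension G

  apex₀ apex₁ : Fin (p G + 2)
  apex₀ = p G ↑ʳ Fin.zero
  apex₁ = p G ↑ʳ Fin.suc Fin.zero

  ends-suspension-inner : ∀ e → ends ΣG (e ↑ˡ (p G + p G)) ≡ (proj₁ (ends G e) ↑ˡ 2 , proj₂ (ends G e) ↑ˡ 2)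
  ends-suspension-inner e rewrite splitAt-↑ˡ (q G) e (p G + p G) = refl

  ends-suspension-apex₀ : ∀ v → ends ΣG (q G ↑ʳ (v ↑ˡ p G)) ≡ (v ↑ˡ 2 , apex₀)
  ends-suspension-apex₀ v rewrite splitAt-↑ʳ (q G) (p G + p G) (v ↑ˡ p G) | splitAt-↑ˡ (p G) v (p G) = refl

  ends-suspension-apex₁ : ∀ v → ends ΣG (q G ↑ʳ (p G ↑ʳ v)) ≡ (v ↑ˡ 2 , apex₁)
  ends-suspension-apex₁ v rewrite splitAt-↑ʳ (q G) (p G + p G) (p G ↑ʳ v) | splitAt-↑ʳ (p G) (p G) v = refl

  module _ (x : Bij ΣG) where

    innerPos : Fin (p G) → ℕ
    innerPos v = vertexPos ΣG x (v ↑ˡ 2)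

    apex₀Pos apex₁Pos : ℕ
    apex₀Pos = vertexPos ΣG x apex₀
    apex₁Pos = vertexPos ΣG x apex₁

    ∑vertexPos-suspension : sum (vertexPos ΣG x) ≡ sum innerPos + (apex₀Pos + apex₁Pos)
    ∑vertexPos-suspension =
      trans (∑-↑ (p G) 2 (vertexPos ΣG x)) (cong (λ a → sum innerPos + (apex₀Pos + a)) (+-identityʳ apex₁Pos))

    apex₀Pos≢apex₁Pos : apex₀Pos ≢ apex₁Pos
    apex₀Pos≢apex₁Pos = FinP.0≢1+n ∘ ↑ʳ-injective (p G) _ _ ∘ inj₁-injective ∘ pos-injective ΣG x

    innerEndsPos : Fin (q G) → ℕ
    innerEndsPos e = innerPos (proj₁ (ends G e)) + innerPos (proj₂ (ends G e))

    ∑endsPos-suspension :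
      sum (endsPos ΣG x) ≡ sum innerEndsPos + ((sum innerPos + p G * apex₀Pos) + (sum innerPos + p G * apex₁Pos))
    ∑endsPos-suspension = begin
      sum (endsPos ΣG x)
        ≡⟨ ∑-↑ (q G) (p G + p G) (endsPos ΣG x) ⟩
      ∑[ e < q G ] endsPos ΣG x (e ↑ˡ (p G + p G)) + sum (endsPos ΣG x ∘ (q G ↑ʳ_))
        ≡⟨ cong₂ _+_ (sum-cong-≗ (cong endsAt ∘ ends-suspension-inner))
                     (∑-↑ (p G) (p G) (endsPos ΣG x ∘ (q G ↑ʳ_))) ⟩
      sum innerEndsPos
        + (∑[ v < p G ] endsPos ΣG x (q G ↑ʳ (v ↑ˡ p G)) + ∑[ v < p G ] endsPos ΣG x (q G ↑ʳ (p G ↑ʳ v)))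
        ≡⟨ cong (sum innerEndsPos +_) (cong₂ _+_ (∑-apex apex₀ (λ v → q G ↑ʳ (v ↑ˡ p G)) ends-suspension-apex₀)
                                                 (∑-apex apex₁ (λ v → q G ↑ʳ (p G ↑ʳ v)) ends-suspension-apex₁)) ⟩
      sum innerEndsPos + ((sum innerPos + p G * apex₀Pos) + (sum innerPos + p G * apex₁Pos)) ∎
      where
      open ≡-Reasoning
      endsAt : Fin (p ΣG) × Fin (p ΣG) → ℕ
      endsAt (u , w) = vertexPos ΣG x u + vertexPos ΣG x w
      ∑-apex : ∀ apex (edge : Fin (p G) → Fin (q ΣG)) → (∀ v → ends ΣG (edge v) ≡ (v ↑ˡ 2 , apex)) →
               ∑[ v < p G ] endsPos ΣG x (edge v) ≡ sum innerPos + p G * vertexPos ΣG x apex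
      ∑-apex apex edge ends-edge = begin
        ∑[ v < p G ] endsPos ΣG x (edge v) ≡⟨ sum-cong-≗ (cong endsAt ∘ ends-edge) ⟩
        ∑[ v < p G ] (innerPos v + a)      ≡⟨ ∑-distrib-+ innerPos (λ _ → a) ⟩
        sum innerPos + ∑[ v < p G ] a      ≡⟨ cong (sum innerPos +_) (∑-const (p G) a) ⟩
        sum innerPos + p G * a             ∎
        where a = vertexPos ΣG x apex

triangle-len-suspension-cycle : ∀ n →
  2 * triangle ((n + 2) + (n + (n + n))) + 4 ≡ 6 * triangle (n + 2) + n + (13 * (n * n) + 2 * n)
triangle-len-suspension-cycle n = +-cancelʳ-≡ (L + 3 * P) _ _ (begin
  2 * triangle L + 4 + (L + 3 * P)     ≡⟨ regroupˡ (triangle L) L P ⟩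
  (2 * triangle L + L) + 4 + 3 * P     ≡⟨ cong (λ t → t + 4 + 3 * P) (2*triangle+n≡n*n L) ⟩
  L * L + 4 + 3 * P                    ≡⟨ polynomial n ⟩
  3 * (P * P) + n + N + L              ≡⟨ cong (λ t → 3 * t + n + N + L) (2*triangle+n≡n*n P) ⟨
  3 * (2 * triangle P + P) + n + N + L ≡⟨ regroupʳ (triangle P) P n N L ⟩
  6 * triangle P + n + N + (L + 3 * P) ∎)
  where
  open ≡-Reasoning
  P = n + 2
  L = (n + 2) + (n + (n + n))
  N = 13 * (n * n) + 2 * n
  regroupˡ : ∀ t L P → 2 * t + 4 + (L + 3 * P) ≡ (2 * t + L) + 4 + 3 * P
  regroupˡ = solve-∀
  regroupʳ : ∀ t P n N L → 3 * (2 * t + P) + n + N + L ≡ 6 * t + n + N + (L + 3 * P)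
  regroupʳ = solve-∀
  polynomial : ∀ n → ((n + 2) + (n + (n + n))) * ((n + 2) + (n + (n + n))) + 4 + 3 * (n + 2)
                   ≡ 3 * ((n + 2) * (n + 2)) + n + (13 * (n * n) + 2 * n) + ((n + 2) + (n + (n + n)))
  polynomial = solve-∀

6*a+n≤[n+2]*a+4 : ∀ n a → 4 ≤ n → 1 ≤ a → 6 * a + n ≤ (n + 2) * a + 4
6*a+n≤[n+2]*a+4 (suc (suc (suc (suc k)))) (suc a) (s≤s (s≤s (s≤s (s≤s z≤n)))) (s≤s z≤n) =
  ≤-trans (m≤m+n _ (k * a)) (≤-reflexive (expand k a))
  where
  expand : ∀ k a → 6 * suc a + (4 + k) + k * a ≡ (4 + k + 2) * suc a + 4
  expand = solve-∀

module _ (m : ℕ) (x : Bij (suspension (cycle (suc m)))) where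

  private
    n = suc m
    ΣCₙ = suspension (cycle n)
    s = sum (innerPos (cycle n) x)
    a₀ = apex₀Pos (cycle n) x
    a₁ = apex₁Pos (cycle n) x

  ∑endsPos-suspension-cycle : sum (endsPos ΣCₙ x) ≡ (s + s) + ((s + n * a₀) + (s + n * a₁))
  ∑endsPos-suspension-cycle =
    trans (∑endsPos-suspension (cycle n) x) (cong (_+ ((s + n * a₀) + (s + n * a₁))) ∑innerEndsPos≡s+s)
    where
    ∑innerEndsPos≡s+s : sum (innerEndsPos (cycle n) x) ≡ s + s
    ∑innerEndsPos≡s+s =
      trans (∑-distrib-+ {n} (innerPos (cycle n) x) (λ e → innerPos (cycle n) x ((suc (toℕ e)) mod n)))
            (cong (s +_) (∑-rotate m (innerPos (cycle n) x)))

  cost-suspension-cycle : IsCSeq ΣCₙ x →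
    cost ΣCₙ x + 6 * s + (n + 2) * (a₀ + a₁) + 4 ≡ 6 * triangle (n + 2) + n + (13 * (n * n) + 2 * n)
  cost-suspension-cycle cs = begin
    cost ΣCₙ x + 6 * s + (n + 2) * (a₀ + a₁) + 4
      ≡⟨ regroup (cost ΣCₙ x) s n a₀ a₁ ⟩
    (cost ΣCₙ x + ((s + s) + ((s + n * a₀) + (s + n * a₁)))) + 2 * (s + (a₀ + a₁)) + 4
      ≡⟨ cong₂ (λ D SV → (cost ΣCₙ x + D) + 2 * SV + 4)
               (sym ∑endsPos-suspension-cycle) (sym (∑vertexPos-suspension (cycle n) x)) ⟩
    (cost ΣCₙ x + sum (endsPos ΣCₙ x)) + 2 * sum (vertexPos ΣCₙ x) + 4
      ≡⟨ cong (λ t → t + 2 * sum (vertexPos ΣCₙ x) + 4) (cost+∑endsPos ΣCₙ x cs) ⟩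
    (sum (edgePos ΣCₙ x) + sum (edgePos ΣCₙ x)) + 2 * sum (vertexPos ΣCₙ x) + 4
      ≡⟨ cong (_+ 4) (double (sum (vertexPos ΣCₙ x)) (sum (edgePos ΣCₙ x))) ⟩
    2 * (sum (vertexPos ΣCₙ x) + sum (edgePos ΣCₙ x)) + 4
      ≡⟨ cong (λ t → 2 * t + 4) (∑vertexPos+∑edgePos≡triangle ΣCₙ x) ⟩
    2 * triangle (len ΣCₙ) + 4
      ≡⟨ triangle-len-suspension-cycle n ⟩
    6 * triangle (n + 2) + n + (13 * (n * n) + 2 * n) ∎
    where
    open ≡-Reasoning
    regroup : ∀ c s n a₀ a₁ → c + 6 * s + (n + 2) * (a₀ + a₁) + 4
                            ≡ (c + ((s + s) + ((s + n * a₀) + (s + n * a₁)))) + 2 * (s + (a₀ + a₁)) + 4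
    regroup = solve-∀
    double : ∀ v e → (e + e) + 2 * v ≡ 2 * (v + e)
    double = solve-∀

  cost-suspension-cycle-≤ : 4 ≤ n → IsCSeq ΣCₙ x → cost ΣCₙ x ≤ 13 * (n * n) + 2 * n
  cost-suspension-cycle-≤ 4≤n cs = +-cancelʳ-≤ (6 * triangle (n + 2) + n) c N (begin
    c + (6 * triangle (n + 2) + n)  ≤⟨ +-monoʳ-≤ c (+-monoˡ-≤ n (*-monoʳ-≤ 6 triangle≤s+a₀+a₁)) ⟩
    c + (6 * (s + (a₀ + a₁)) + n)   ≡⟨ regroup c s (a₀ + a₁) n ⟩
    c + 6 * s + (6 * (a₀ + a₁) + n) ≤⟨ +-monoʳ-≤ (c + 6 * s) (6*a+n≤[n+2]*a+4 n (a₀ + a₁) 4≤n 1≤a₀+a₁) ⟩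
    c + 6 * s + ((n + 2) * (a₀ + a₁) + 4) ≡⟨ +-assoc (c + 6 * s) _ 4 ⟨
    c + 6 * s + (n + 2) * (a₀ + a₁) + 4   ≡⟨ cost-suspension-cycle cs ⟩
    6 * triangle (n + 2) + n + N          ≡⟨ +-comm _ N ⟩
    N + (6 * triangle (n + 2) + n)        ∎)
    where
    open ≤-Reasoning
    c = cost ΣCₙ x
    N = 13 * (n * n) + 2 * n
    triangle≤s+a₀+a₁ : triangle (n + 2) ≤ s + (a₀ + a₁)
    triangle≤s+a₀+a₁ = ≤-trans (triangle≤∑vertexPos ΣCₙ x) (≤-reflexive (∑vertexPos-suspension (cycle n) x))
    1≤a₀+a₁ : 1 ≤ a₀ + a₁
    1≤a₀+a₁ = ≢⇒1≤+ (apex₀Pos≢apex₁Pos (cycle n) x)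
    regroup : ∀ c s a n → c + (6 * (s + a) + n) ≡ c + 6 * s + (6 * a + n)
    regroup = solve-∀

  cost-suspension-cycle-≡ : IsCSeq ΣCₙ x → sum (vertexPos ΣCₙ x) ≡ triangle (n + 2) → a₀ + a₁ ≡ 1 →
                            cost ΣCₙ x ≡ 13 * (n * n) + 2 * n
  cost-suspension-cycle-≡ cs ∑vertexPos≡triangle a₀+a₁≡1 = +-cancelʳ-≡ (6 * triangle (n + 2) + n) c N (begin
    c + (6 * triangle (n + 2) + n)       ≡⟨ cong (λ t → c + (6 * t + n)) s+a₀+a₁≡triangle ⟨
    c + (6 * (s + (a₀ + a₁)) + n)        ≡⟨ cong (λ a → c + (6 * (s + a) + n)) a₀+a₁≡1 ⟩
    c + (6 * (s + 1) + n)                ≡⟨ regroup c s n ⟩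
    c + 6 * s + (n + 2) * 1 + 4          ≡⟨ cong (λ a → c + 6 * s + (n + 2) * a + 4) a₀+a₁≡1 ⟨
    c + 6 * s + (n + 2) * (a₀ + a₁) + 4  ≡⟨ cost-suspension-cycle cs ⟩
    6 * triangle (n + 2) + n + N         ≡⟨ +-comm _ N ⟩
    N + (6 * triangle (n + 2) + n)       ∎)
    where
    open ≡-Reasoning
    c = cost ΣCₙ x
    N = 13 * (n * n) + 2 * n
    s+a₀+a₁≡triangle : s + (a₀ + a₁) ≡ triangle (n + 2)
    s+a₀+a₁≡triangle = trans (sym (∑vertexPos-suspension (cycle n) x)) ∑vertexPos≡triangle
    regroup : ∀ c s n → c + (6 * (s + 1) + n) ≡ c + 6 * s + (n + 2) * 1 + 4
    regroup = solve-∀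

module _ (G : Graph) where

  private
    ΣG = suspension G

  -- Sends a vertex to its place: the two apexes first, then the vertices of G in order.
  apexesFirstOrder : Fin (p ΣG) ↔ Fin (p ΣG)
  apexesFirstOrder =
    ↔-trans (+↔⊎ {p G}) (↔-trans (⊎-comm _ _) (↔-trans (↔-sym (+↔⊎ {2})) (cast-id (+-comm 2 (p G)))))

  apexesFirst : Bij ΣG
  apexesFirst = ↔-sym (↔-trans (apexesFirstOrder ⊎-↔ ↔-refl) (↔-sym +↔⊎))

  apexesFirst-vertexPos : ∀ v → vertexPos ΣG apexesFirst v ≡ toℕ (Inverse.to apexesFirstOrder v)
  apexesFirst-vertexPos v = toℕ-↑ˡ (Inverse.to apexesFirstOrder v) (q ΣG)

  apexesFirst-isCSeq : IsCSeq ΣG apexesFirst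
  apexesFirst-isCSeq e = vertex<edge (proj₁ (ends ΣG e)) , vertex<edge (proj₂ (ends ΣG e))
    where
    vertex<edge : ∀ v → vertexPos ΣG apexesFirst v < edgePos ΣG apexesFirst e
    vertex<edge v = begin-strict
      vertexPos ΣG apexesFirst v          ≡⟨ apexesFirst-vertexPos v ⟩
      toℕ (Inverse.to apexesFirstOrder v) <⟨ toℕ<n (Inverse.to apexesFirstOrder v) ⟩
      p ΣG                                ≤⟨ m≤m+n (p ΣG) (toℕ e) ⟩
      p ΣG + toℕ e                        ≡⟨ toℕ-↑ʳ (p ΣG) e ⟨
      edgePos ΣG apexesFirst e            ∎
      where open ≤-Reasoning

  apexesFirst-∑vertexPos : sum (vertexPos ΣG apexesFirst) ≡ triangle (p ΣG)
  apexesFirst-∑vertexPos = begin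
    sum (vertexPos ΣG apexesFirst)                     ≡⟨ sum-cong-≗ apexesFirst-vertexPos ⟩
    ∑[ v < p ΣG ] toℕ (Inverse.to apexesFirstOrder v)  ≡⟨ sum-permute toℕ apexesFirstOrder ⟨
    ∑[ i < p ΣG ] toℕ i                                ≡⟨ ∑-toℕ (p ΣG) ⟩
    triangle (p ΣG)                                    ∎
    where open ≡-Reasoning

  apexesFirst-apexPos : ∀ i → vertexPos ΣG apexesFirst (p G ↑ʳ i) ≡ toℕ i
  apexesFirst-apexPos i = begin
    vertexPos ΣG apexesFirst (p G ↑ʳ i)
      ≡⟨ apexesFirst-vertexPos (p G ↑ʳ i) ⟩
    toℕ (Fin.cast _ (Fin.join 2 (p G) (swap (splitAt (p G) (p G ↑ʳ i)))))
      ≡⟨ toℕ-cast _ _ ⟩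
    toℕ (Fin.join 2 (p G) (swap (splitAt (p G) (p G ↑ʳ i))))
      ≡⟨ cong (toℕ ∘ Fin.join 2 (p G) ∘ swap) (splitAt-↑ʳ (p G) 2 i) ⟩
    toℕ (i ↑ˡ p G)
      ≡⟨ toℕ-↑ˡ i (p G) ⟩
    toℕ i ∎
    where open ≡-Reasoning

  apexesFirst-apex₀Pos+apex₁Pos : apex₀Pos G apexesFirst + apex₁Pos G apexesFirst ≡ 1
  apexesFirst-apex₀Pos+apex₁Pos =
    cong₂ _+_ (apexesFirst-apexPos Fin.zero) (apexesFirst-apexPos (Fin.suc Fin.zero))

theorem12 : (n : ℕ) → 4 ≤ n → MaxCost (suspension (cycle n)) (13 * (n * n) + 2 * n)
theorem12 zero    ()
theorem12 (suc m) 4≤n =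
  (apexesFirst Cₙ , apexesFirst-isCSeq Cₙ , attained) , λ x → cost-suspension-cycle-≤ m x 4≤n
  where
  Cₙ = cycle (suc m)
  attained : cost (suspension Cₙ) (apexesFirst Cₙ) ≡ 13 * (suc m * suc m) + 2 * suc m
  attained = cost-suspension-cycle-≡ m (apexesFirst Cₙ) (apexesFirst-isCSeq Cₙ)
               (apexesFirst-∑vertexPos Cₙ) (apexesFirst-apex₀Pos+apex₁Pos Cₙ)
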